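{- If a finite bipartite graph $G$ contains an invertible pair, then $G$ is not a cocomparability bigraph.
   Context: Let $(X,Y)$ be a bipartition of $G$. Two edges $xy, x'y'$ ($x,x'\in X$, $y,y'\in Y$) are independent if $x\ne x'$, $y\ne y'$, and $xy'\notin E(G)$, $x'y\notin E(G)$. Two walks $a_1\dots a_k$ and $b_1\dots b_k$ with $a_1,b_1$ in the same part are congruent if for each $i=1,\dots,k-1$ the edges $a_ia_{i+1}$ and $b_ib_{i+1}$ are independent. A pair of vertices $u,v$ is an invertible pair if there are congruent walks $W$ from $u$ to $v$ and $W'$ from $v$ to $u$. $G$ is a cocomparability bigraph if there exist linear orderings $\prec_X$ of $X$ and $\prec_Y$ of $Y$ such that for all $u,v\in X$, $w,z\in Y$ with $u\prec_X v$, $w\prec_Y z$ and $uz,vw\in E(G)$, at least one of $uw,vz$ is in $E(G)$. -}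

module Defs where

open import Level using (0ℓ)
open import Data.Nat using (ℕ)
open import Data.Fin using (Fin)
open import Data.Bool using (Bool; true)
open import Data.Sum using (_⊎_; inj₁; inj₂)
open import Data.Product using (Σ; _×_)
open import Data.Empty using (⊥)
open import Data.Unit using (⊤)
open import Relation.Nullary using (¬_)
open import Relation.Binary.Core using (Rel)
open import Relation.Binary.Structures using (IsStrictTotalOrder)
open import Relation.Binary.PropositionalEquality using (_≡_; _≢_)

-- A finite bipartite graph with fixed bipartition (X , Y), X = Fin m, Y = Fin n.
-- Edges are given by a Boolean adjacency matrix between X and Y.
record BipGraph : Set where
  field
    m n : ℕ
    adj : Fin m → Fin n → Bool

module _ (G : BipGraph) where
  open BipGraph G

  Edge : Fin m → Fin n → Set
  Edge x y = adj x y ≡ true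

  Vertex : Set
  Vertex = Fin m ⊎ Fin n

  SamePart : Vertex → Vertex → Set
  SamePart (inj₁ _) (inj₁ _) = ⊤
  SamePart (inj₂ _) (inj₂ _) = ⊤
  SamePart _ _ = ⊥

  Independent : Fin m → Fin n → Fin m → Fin n → Set
  Independent x y x' y' =
    Edge x y × Edge x' y' × x ≢ x' × y ≢ y' × ¬ Edge x y' × ¬ Edge x' y

  IndepSteps : Vertex → Vertex → Vertex → Vertex → Set
  IndepSteps (inj₁ x) (inj₂ y) (inj₁ x') (inj₂ y') = Independent x y x' y'
  IndepSteps (inj₂ y) (inj₁ x) (inj₂ y') (inj₁ x') = Independent x y x' y'
  IndepSteps _ _ _ _ = ⊥

  -- CongruentWalks a v b w : there are congruent walks a = a₁ … a_k = v and
  -- b = b₁ … b_k = w (same length k ≥ 1, a₁ and b₁ in the same part).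
  data CongruentWalks : Vertex → Vertex → Vertex → Vertex → Set where
    stop : ∀ {a b} → SamePart a b → CongruentWalks a a b b
    step : ∀ {a a' b b' v w} → IndepSteps a a' b b' →
           CongruentWalks a' v b' w → CongruentWalks a v b w

  InvertiblePair : Vertex → Vertex → Set
  InvertiblePair u v = u ≢ v × CongruentWalks u v v u

  HasInvertiblePair : Set
  HasInvertiblePair = Σ Vertex λ u → Σ Vertex λ v → InvertiblePair u v

  IsCocomparabilityBigraph : Set₁
  IsCocomparabilityBigraph =
    Σ (Rel (Fin m) 0ℓ) λ _≺X_ → Σ (Rel (Fin n) 0ℓ) λ _≺Y_ →
      IsStrictTotalOrder _≡_ _≺X_ × IsStrictTotalOrder _≡_ _≺Y_ ×
      (∀ u v w z → u ≺X v → w ≺Y z → Edge u z → Edge v w →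
         Edge u w ⊎ Edge v z)

module Submission where

-- Idea: a cocomparability ordering (≺X , ≺Y) induces a strict total order ⊏
-- on all vertices (X before Y, and ≺X resp. ≺Y inside each part).  The
-- defining condition of the ordering says exactly that two independent edges
-- xy, x'y' are "parallel": x ≺X x' forces y ≺Y y' and vice versa.  Hence each
-- pair of independent steps preserves ⊏, and by induction so does every pair
-- of congruent walks.  Congruent walks u → v and v → u would then turn
-- u ⊏ v into v ⊏ u (and, read backwards, v ⊏ u into u ⊏ v), which a
-- trichotomous order forbids for distinct u and v.

open import Defs
open import Level using (0ℓ)
open import Data.Fin using (Fin)
open import Data.Sum using (_⊎_; inj₁; inj₂)
open import Data.Sum.Relation.Binary.LeftOrder
  using (_⊎-<_; ₁∼₁; ₂∼₂; ⊎-<-trichotomous)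
open import Data.Sum.Relation.Binary.Pointwise using (Pointwise-≡⇒≡)
open import Data.Product using (_,_)
open import Data.Unit using (tt)
open import Relation.Nullary using (¬_; contradiction)
open import Relation.Binary.Core using (Rel; _⇒_)
open import Relation.Binary.Definitions using (Trichotomous; tri<; tri≈; tri>)
open import Relation.Binary.Structures using (IsStrictTotalOrder)
open import Relation.Binary.PropositionalEquality using (_≡_; sym)

module CongruentWalkFacts (G : BipGraph) where

  independent-sym : ∀ {x y x' y'} →
                    Independent G x y x' y' → Independent G x' y' x y
  independent-sym (xy , x'y' , x≢x' , y≢y' , ¬xy' , ¬x'y) =
    x'y' , xy , (λ eq → x≢x' (sym eq)) , (λ eq → y≢y' (sym eq)) , ¬x'y , ¬xy'

  indepSteps-sym : ∀ {a a' b b'} → IndepSteps G a a' b b' → IndepSteps G b b' a a'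
  indepSteps-sym {inj₁ _} {inj₂ _} {inj₁ _} {inj₂ _} i = independent-sym i
  indepSteps-sym {inj₂ _} {inj₁ _} {inj₂ _} {inj₁ _} i = independent-sym i

  samePart-sym : ∀ {a b} → SamePart G a b → SamePart G b a
  samePart-sym {inj₁ _} {inj₁ _} _ = tt
  samePart-sym {inj₂ _} {inj₂ _} _ = tt

  congruent-sym : ∀ {a v b w} → CongruentWalks G a v b w → CongruentWalks G b w a v
  congruent-sym (stop same) = stop (samePart-sym same)
  congruent-sym (step i walks) = step (indepSteps-sym i) (congruent-sym walks)

  congruent-preserves : ∀ {ℓ} {R : Rel (Vertex G) ℓ} →
    (∀ {a a' b b'} → IndepSteps G a a' b b' → R a b → R a' b') →
    ∀ {a v b w} → CongruentWalks G a v b w → R a b → R v w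
  congruent-preserves preserve (stop _) r = r
  congruent-preserves preserve (step i walks) r =
    congruent-preserves preserve walks (preserve i r)

  no-invertible-pair : ∀ {ℓ₁ ℓ₂} {_≈_ : Rel (Vertex G) ℓ₁} {_⊏_ : Rel (Vertex G) ℓ₂} →
    _≈_ ⇒ _≡_ → Trichotomous _≈_ _⊏_ →
    (∀ {a a' b b'} → IndepSteps G a a' b b' → a ⊏ b → a' ⊏ b') →
    ¬ HasInvertiblePair G
  no-invertible-pair ≈⇒≡ compare preserve (u , v , u≢v , walks) with compare u v
  ... | tri< u⊏v _ ¬v⊏u = ¬v⊏u (congruent-preserves preserve walks u⊏v)
  ... | tri≈ _ u≈v _ = u≢v (≈⇒≡ u≈v)
  ... | tri> ¬u⊏v _ v⊏u =
    ¬u⊏v (congruent-preserves preserve (congruent-sym walks) v⊏u)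

module CocomparabilityFacts (G : BipGraph)
  (_≺X_ : Rel (Fin (BipGraph.m G)) 0ℓ) (_≺Y_ : Rel (Fin (BipGraph.n G)) 0ℓ) where

  Cocomparable : Set
  Cocomparable = ∀ u v w z → u ≺X v → w ≺Y z → Edge G u z → Edge G v w →
                 Edge G u w ⊎ Edge G v z

  parallel-X⇒Y : Trichotomous _≡_ _≺Y_ → Cocomparable →
                 ∀ {x y x' y'} → Independent G x y x' y' → x ≺X x' → y ≺Y y'
  parallel-X⇒Y compareY cocomp {x} {y} {x'} {y'}
               (xy , x'y' , _ , y≢y' , ¬xy' , ¬x'y) x≺x' with compareY y y'
  ... | tri< y≺y' _ _ = y≺y'
  ... | tri≈ _ y≡y' _ = contradiction y≡y' y≢y'
  ... | tri> _ _ y'≺y with cocomp x x' y' y x≺x' y'≺y xy x'y'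
  ...   | inj₁ xy' = contradiction xy' ¬xy'
  ...   | inj₂ x'y = contradiction x'y ¬x'y

  parallel-Y⇒X : Trichotomous _≡_ _≺X_ → Cocomparable →
                 ∀ {x y x' y'} → Independent G x y x' y' → y ≺Y y' → x ≺X x'
  parallel-Y⇒X compareX cocomp {x} {y} {x'} {y'}
               (xy , x'y' , x≢x' , _ , ¬xy' , ¬x'y) y≺y' with compareX x x'
  ... | tri< x≺x' _ _ = x≺x'
  ... | tri≈ _ x≡x' _ = contradiction x≡x' x≢x'
  ... | tri> _ _ x'≺x with cocomp x' x y y' x'≺x y≺y' x'y' xy
  ...   | inj₁ x'y = contradiction x'y ¬x'y
  ...   | inj₂ xy' = contradiction xy' ¬xy'

  _⊏_ : Rel (Vertex G) 0ℓ
  _⊏_ = _≺X_ ⊎-< _≺Y_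

  -- Independent steps preserve ⊏ (steps starting in different parts are never
  -- independent, so only the two parallel-edge cases occur).
  indepSteps-preserve-⊏ : Trichotomous _≡_ _≺X_ → Trichotomous _≡_ _≺Y_ →
    Cocomparable → ∀ {a a' b b'} → IndepSteps G a a' b b' → a ⊏ b → a' ⊏ b'
  indepSteps-preserve-⊏ compareX compareY cocomp {a' = inj₂ _} {b' = inj₂ _} i (₁∼₁ x≺x') =
    ₂∼₂ (parallel-X⇒Y compareY cocomp i x≺x')
  indepSteps-preserve-⊏ compareX compareY cocomp {a' = inj₁ _} {b' = inj₁ _} i (₂∼₂ y≺y') =
    ₁∼₁ (parallel-Y⇒X compareX cocomp i y≺y')

corollary2p3 : (G : BipGraph) → HasInvertiblePair G → ¬ IsCocomparabilityBigraph G
corollary2p3 G invertible (_≺X_ , _≺Y_ , orderX , orderY , cocomp) =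
  no-invertible-pair Pointwise-≡⇒≡ (⊎-<-trichotomous compareX compareY)
    (indepSteps-preserve-⊏ compareX compareY cocomp) invertible
  where
  open CongruentWalkFacts G
  open CocomparabilityFacts G _≺X_ _≺Y_
  compareX : Trichotomous _≡_ _≺X_
  compareX = IsStrictTotalOrder.compare orderX
  compareY : Trichotomous _≡_ _≺Y_
  compareY = IsStrictTotalOrder.compare orderY
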